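{- For all $n,d\in\mathbb{N}$ there exists a graph $G_{n,d}$ such that: $G_{n,d}$ has $\frac{3}{2}\binom{2d}{d}n+2d$ vertices; the treedepth of $G_{n,d}$ is at most $2d+2$; and the graph $(G_{n,d})^2$ has at least $n^{\frac{1}{2}\binom{2d}{d}}$ different inclusion-wise maximal cliques.
   Context: All graphs are finite, simple and undirected. $G^2$ is the graph on $V(G)$ where distinct $u,v$ are adjacent iff their distance in $G$ is at most $2$. The treedepth of a graph $G$ is the minimum height (maximum number of vertices on a root-to-leaf path) of a rooted forest $F$ on vertex set $V(G)$ such that every edge of $G$ joins two vertices one of which is an ancestor of the other in $F$. -}

module Defs where

open import Data.Nat using (ℕ; zero; suc; _≤_)
open import Data.Fin using (Fin)
open import Data.Fin.Subset using (Subset; _∈_; _⊆_)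
open import Data.Maybe using (Maybe; just; nothing)
open import Data.Product using (Σ; _×_; _,_; proj₁)
open import Data.Sum using (_⊎_; inj₁; inj₂)
open import Data.Empty using (⊥)
open import Relation.Binary.PropositionalEquality using (_≡_; _≢_; refl; ≢-sym)

record Graph (N : ℕ) : Set₁ where
  field
    Adj   : Fin N → Fin N → Set
    sym   : ∀ {u v} → Adj u v → Adj v u
    irrefl : ∀ {u} → Adj u u → ⊥
open Graph public

Adj² : ∀ {N} → Graph N → Fin N → Fin N → Set
Adj² {N} G u v = (u ≢ v) × (Adj G u v ⊎ Σ (Fin N) λ w → Adj G u w × Adj G w v)

sym² : ∀ {N} (G : Graph N) {u v} → Adj² G u v → Adj² G v u
sym² G (ne , inj₁ e) = ≢-sym ne , inj₁ (sym G e)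
sym² G (ne , inj₂ (w , e₁ , e₂)) = ≢-sym ne , inj₂ (w , sym G e₂ , sym G e₁)

square : ∀ {N} → Graph N → Graph N
square G = record { Adj = Adj² G ; sym = sym² G ; irrefl = λ p → proj₁ p refl }

data Depth {N : ℕ} (parent : Fin N → Maybe (Fin N)) : Fin N → ℕ → Set where
  root  : ∀ {v} → parent v ≡ nothing → Depth parent v 1
  child : ∀ {u v k} → parent v ≡ just u → Depth parent u k → Depth parent v (suc k)

data Ancestor {N : ℕ} (parent : Fin N → Maybe (Fin N)) : Fin N → Fin N → Set where
  par  : ∀ {u v} → parent v ≡ just u → Ancestor parent u v
  step : ∀ {u w v} → Ancestor parent u w → parent v ≡ just w → Ancestor parent u v

-- Treedepth of G is at most h: there is a rooted forest on V(G) (every vertex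
-- reaches a root, i.e. no cycles) of height ≤ h (every root-to-vertex path has
-- at most h vertices) such that every edge joins an ancestor–descendant pair.
TreedepthAtMost : ∀ {N} → Graph N → ℕ → Set
TreedepthAtMost {N} G h =
  Σ (Fin N → Maybe (Fin N)) λ parent →
    (∀ v → Σ ℕ λ k → Depth parent v k × k ≤ h) ×
    (∀ u v → Adj G u v → Ancestor parent u v ⊎ Ancestor parent v u)

IsClique : ∀ {N} → Graph N → Subset N → Set
IsClique G S = ∀ u v → u ∈ S → v ∈ S → u ≢ v → Adj G u v

IsMaximalClique : ∀ {N} → Graph N → Subset N → Set
IsMaximalClique G S = IsClique G S × (∀ T → IsClique G T → S ⊆ T → T ⊆ S)

AtLeastMaxCliques : ∀ {N} → Graph N → ℕ → Set
AtLeastMaxCliques {N} G m =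
  Σ (Fin m → Subset N) λ f →
    (∀ i j → f i ≡ f j → i ≡ j) × (∀ i → IsMaximalClique G (f i))

module Submission where

-- G has 2d hubs forming a clique and, for each of the m = C(2d,d)/2 blocks p and each
-- j < n, a path a–c–b whose end a is joined to the hubs of a d-set A p and whose end
-- b to the remaining hubs.  Hanging every c below a chain through the hubs, and a, b
-- below c, gives treedepth ≤ 2d + 2.  For each f : Fin m → Fin n the hubs together with
-- a_{p,f p} and b_{p,f p} (p < m) are pairwise at distance ≤ 2: two a's share the hub 0
-- common to all A p, a_p and b_q share a hub of A p ∖ A q, two b's share a hub outside
-- A p ∪ A q.  The clique is maximal since a_{p,j} with j ≠ f p is at distance 3 from
-- b_{p,f p}, and c-vertices are far from the other blocks; distinct f give distinct
-- cliques, so G² has n ^ m maximal cliques.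

open import Defs hiding (sym)
open import Level using (0ℓ)
open import Data.Bool using (true)
open import Data.Empty using (⊥-elim)
open import Data.Unit using (⊤; tt)
open import Data.Nat using (ℕ; zero; suc; _+_; _*_; _^_; _∸_; _≤_; _<_; s≤s)
open import Data.Nat.Properties
  using (<⇒≤; <-irrefl; ≤-trans; ≤-reflexive; +-comm; +-identityʳ; *-comm; n≤1+n; m≤m+n; m≤n+m;
         +-monoʳ-<; m+n≤o⇒m≤o∸n; m+n∸n≡m)
open import Data.Nat.DivMod using (_/_; m*n/n≡m)
open import Data.Nat.Combinatorics using (_C_; nCk+nC[k+1]≡[n+1]C[k+1]; nCk≡nC[n∸k])
open import Data.Fin as Fin using (Fin; zero; suc; toℕ; inject₁; fromℕ; splitAt; cast; finToFun; funToFin; combine)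
open import Data.Fin.Properties as Finₚ
  using (cast-involutive; toℕ-inject₁; toℕ-fromℕ; toℕ<n; ≤fromℕ; ≤∧≢⇒<; <⇒≤pred; <-cmp; all?; ¬∀⟶∃¬;
         funToFin-finToFin; +↔⊎; *↔×)
open import Data.Fin.Induction using (<-weakInduction)
open import Data.Fin.Subset using (Subset; inside; outside; _∈_; _∉_; _⊆_; ∣_∣; ∁; ⊥)
open import Data.Fin.Subset.Properties using (drop-there; ∣∁p∣≡n∸∣p∣; x∈∁p⇒x∉p; ∣⊥∣≡0; _∈?_)
open import Data.Vec using ([]; _∷_; here; there; tail; tabulate)
open import Data.Vec.Properties using (lookup∘tabulate; []=⇒lookup; lookup⇒[]=)
open import Data.Maybe as Maybe using (Maybe; just; nothing)
open import Data.Product using (Σ; ∃-syntax; _×_; _,_; proj₁; proj₂; map₁; map₂)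
open import Data.Product.Function.NonDependent.Propositional using (_×-↔_)
open import Data.Sum using (_⊎_; inj₁; inj₂; [_,_]; swap) renaming (map to ⊎-map)
open import Data.Sum.Function.Propositional using (_⊎-↔_)
open import Function using (_∘_; _↔_; Inverse; Injection)
open import Function.Definitions using (Injective)
open import Function.Consequences.Propositional using (inverseʳ⇒injective; strictlyInverseʳ⇒inverseʳ)
open import Function.Construct.Composition using (_↔-∘_)
open import Function.Construct.Identity using (↔-id)
open import Function.Properties.Inverse using (↔⇒↣)
open import Relation.Binary.Definitions using (tri<; tri≈; tri>)
open import Relation.Binary.PropositionalEquality hiding ([_])
open import Relation.Nullary using (¬_; yes; no; does; contradiction)
open import Relation.Nullary.Decidable using (dec-true; dec-false; decidable-stable; _×-dec_)
open import Relation.Unary using (Pred; Decidable)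

∣q∣<∣p∣⇒∃∈p∉q : ∀ {n} {p q : Subset n} → ∣ q ∣ < ∣ p ∣ → ∃[ x ] x ∈ p × x ∉ q

∣q∣≤∣p∣∧p≢q⇒∃∈p∉q : ∀ {n} {p q : Subset n} → ∣ q ∣ ≤ ∣ p ∣ → p ≢ q → ∃[ x ] x ∈ p × x ∉ q
∣q∣≤∣p∣∧p≢q⇒∃∈p∉q {p = []}          {[]}          _ p≢q = ⊥-elim (p≢q refl)
∣q∣≤∣p∣∧p≢q⇒∃∈p∉q {p = inside ∷ p}  {outside ∷ q} _ _ = zero , here , λ ()
∣q∣≤∣p∣∧p≢q⇒∃∈p∉q {p = inside ∷ p}  {inside ∷ q}  (s≤s q≤p) p≢q
  with x , x∈p , x∉q ← ∣q∣≤∣p∣∧p≢q⇒∃∈p∉q q≤p (p≢q ∘ cong (inside ∷_))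
  = suc x , there x∈p , x∉q ∘ drop-there
∣q∣≤∣p∣∧p≢q⇒∃∈p∉q {p = outside ∷ p} {outside ∷ q} q≤p p≢q
  with x , x∈p , x∉q ← ∣q∣≤∣p∣∧p≢q⇒∃∈p∉q q≤p (p≢q ∘ cong (outside ∷_))
  = suc x , there x∈p , x∉q ∘ drop-there
∣q∣≤∣p∣∧p≢q⇒∃∈p∉q {p = outside ∷ p} {inside ∷ q}  q<p _
  with x , x∈p , x∉q ← ∣q∣<∣p∣⇒∃∈p∉q q<p
  = suc x , there x∈p , x∉q ∘ drop-there

∣q∣<∣p∣⇒∃∈p∉q q<p = ∣q∣≤∣p∣∧p≢q⇒∃∈p∉q (<⇒≤ q<p) (λ p≡q → <-irrefl (cong ∣_∣ (sym p≡q)) q<p)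

∣p∣+∣q∣<n⇒∃∉p∉q : ∀ {n} (p q : Subset n) → ∣ p ∣ + ∣ q ∣ < n → ∃[ x ] x ∉ p × x ∉ q
∣p∣+∣q∣<n⇒∃∉p∉q {n} p q size = map₂ (map₁ x∈∁p⇒x∉p) (∣q∣<∣p∣⇒∃∈p∉q q<∁p)
  where
  q<∁p : ∣ q ∣ < ∣ ∁ p ∣
  q<∁p rewrite ∣∁p∣≡n∸∣p∣ p =
    m+n≤o⇒m≤o∸n (suc ∣ q ∣) (subst (_≤ n) (cong suc (+-comm ∣ p ∣ ∣ q ∣)) size)

toSubset : ∀ {n} {P : Pred (Fin n) 0ℓ} → Decidable P → Subset n
toSubset P? = tabulate (does ∘ P?)

module _ {n} {P : Pred (Fin n) 0ℓ} (P? : Decidable P) where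

  ∈-toSubset⁺ : ∀ {x} → P x → x ∈ toSubset P?
  ∈-toSubset⁺ {x} px = lookup⇒[]= x _ (trans (lookup∘tabulate _ x) (dec-true (P? x) px))

  ∈-toSubset⁻ : ∀ {x} → x ∈ toSubset P? → P x
  ∈-toSubset⁻ {x} x∈ = decidable-stable (P? x) λ ¬px →
    contradiction (trans (sym (lookup∘tabulate _ x)) ([]=⇒lookup x∈)) (subst (_≢ true) (sym (dec-false (P? x) ¬px)) λ ())

pascalSplit : ∀ n k → Fin (suc n C suc k) → Fin (n C k) ⊎ Fin (n C suc k)
pascalSplit n k = splitAt (n C k) ∘ cast (sym (nCk+nC[k+1]≡[n+1]C[k+1] n k))

pascalSplit-injective : ∀ n k → Injective _≡_ _≡_ (pascalSplit n k)
pascalSplit-injective n k = cast-injective ∘ splitAt-injective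
  where
  pascal : n C k + n C suc k ≡ suc n C suc k
  pascal = nCk+nC[k+1]≡[n+1]C[k+1] n k
  cast-injective : Injective _≡_ _≡_ (cast (sym pascal))
  cast-injective = inverseʳ⇒injective (cast (sym pascal))
    (strictlyInverseʳ⇒inverseʳ {f⁻¹ = cast pascal} (cast (sym pascal)) (cast-involutive pascal (sym pascal)))
  splitAt-injective : Injective _≡_ _≡_ (splitAt (n C k) {n C suc k})
  splitAt-injective = Injection.injective (↔⇒↣ +↔⊎)

choose : ∀ n k → Fin (n C k) → Subset n
choose⊎ : ∀ n k → Fin (n C k) ⊎ Fin (n C suc k) → Subset (suc n)

choose n       zero    _ = ⊥
choose (suc n) (suc k) i = choose⊎ n k (pascalSplit n k i)

choose⊎ n k (inj₁ i) = inside ∷ choose n k i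
choose⊎ n k (inj₂ i) = outside ∷ choose n (suc k) i

∣choose∣≡k : ∀ n k i → ∣ choose n k i ∣ ≡ k
∣choose⊎∣≡1+k : ∀ n k i → ∣ choose⊎ n k i ∣ ≡ suc k

∣choose∣≡k n       zero    _ = ∣⊥∣≡0 n
∣choose∣≡k (suc n) (suc k) i = ∣choose⊎∣≡1+k n k (pascalSplit n k i)

∣choose⊎∣≡1+k n k (inj₁ i) = cong suc (∣choose∣≡k n k i)
∣choose⊎∣≡1+k n k (inj₂ i) = ∣choose∣≡k n (suc k) i

choose-injective : ∀ n k → Injective _≡_ _≡_ (choose n k)
choose⊎-injective : ∀ n k → Injective _≡_ _≡_ (choose⊎ n k)

choose-injective n       zero    {zero} {zero} _ = refl
choose-injective (suc n) (suc k) eq = pascalSplit-injective n k (choose⊎-injective n k eq)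

choose⊎-injective n k {inj₁ i} {inj₁ j} eq = cong inj₁ (choose-injective n k (cong tail eq))
choose⊎-injective n k {inj₂ i} {inj₂ j} eq = cong inj₂ (choose-injective n (suc k) (cong tail eq))

[2+2e]C[1+e]/2≡[1+2e]Ce : ∀ e → ((2 * suc e) C suc e) / 2 ≡ (2 * suc e ∸ 1) C e
[2+2e]C[1+e]/2≡[1+2e]Ce e = begin
  (suc K C suc e) / 2          ≡⟨ cong (_/ 2) (nCk+nC[k+1]≡[n+1]C[k+1] K e) ⟨
  (K C e + K C suc e) / 2      ≡⟨ cong (λ x → (K C e + x) / 2) KC[1+e]≡KCe ⟩
  (K C e + K C e) / 2          ≡⟨ cong (λ x → (K C e + x) / 2) (+-identityʳ (K C e)) ⟨
  (2 * (K C e)) / 2            ≡⟨ cong (_/ 2) (*-comm 2 (K C e)) ⟩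
  ((K C e) * 2) / 2            ≡⟨ m*n/n≡m (K C e) 2 ⟩
  K C e                        ∎
  where
  open ≡-Reasoning
  K : ℕ
  K = 2 * suc e ∸ 1
  1+e≤K : suc e ≤ K
  1+e≤K = ≤-trans (s≤s (m≤m+n e 0)) (m≤n+m _ e)
  K∸[1+e]≡e : K ∸ suc e ≡ e
  K∸[1+e]≡e = trans (cong (λ k → e + suc k ∸ suc e) (+-identityʳ e)) (m+n∸n≡m e (suc e))
  KC[1+e]≡KCe : K C suc e ≡ K C e
  KC[1+e]≡KCe = trans (nCk≡nC[n∸k] 1+e≤K) (cong (K C_) K∸[1+e]≡e)

isMaximalClique-byEscape : ∀ {N} (G : Graph N) (S : Subset N) → IsClique G S →
  (∀ {u} → u ∉ S → ∃[ v ] v ∈ S × ¬ Adj G u v) → IsMaximalClique G S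
isMaximalClique-byEscape G S clique escape = clique , maximal
  where
  maximal : ∀ T → IsClique G T → S ⊆ T → T ⊆ S
  maximal T T-clique S⊆T {u} u∈T with u ∈? S
  ... | yes u∈S = u∈S
  ... | no u∉S with v , v∈S , ¬uv ← escape u∉S
    = ⊥-elim (¬uv (T-clique u v u∈T (S⊆T v∈S) λ { refl → u∉S v∈S }))

funToFin-cong : ∀ {m n} {f g : Fin m → Fin n} → f ≗ g → funToFin f ≡ funToFin g
funToFin-cong {zero}  _   = refl
funToFin-cong {suc m} f≗g = cong₂ combine (f≗g zero) (funToFin-cong (f≗g ∘ suc))

finToFun-injective : ∀ {m n} {i j : Fin (n ^ m)} → finToFun {n} {m} i ≗ finToFun j → i ≡ j
finToFun-injective {m} {n} {i} {j} i≗j =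
  trans (sym (funToFin-finToFin {m} {n} i)) (trans (funToFin-cong i≗j) (funToFin-finToFin {m} {n} j))

atLeastMaxCliques-^ : ∀ {N m n} (G : Graph N) (S : (Fin m → Fin n) → Subset N) →
  (∀ {f g} → S f ≡ S g → f ≗ g) → (∀ f → IsMaximalClique G (S f)) → AtLeastMaxCliques G (n ^ m)
atLeastMaxCliques-^ {m = m} {n} G S S-injective maximal =
  S ∘ finToFun , (λ _ _ → finToFun-injective {m} {n} ∘ S-injective) , maximal ∘ finToFun {n} {m}

module Chain {N K : ℕ} (parent : Fin N → Maybe (Fin N)) (node : Fin (suc K) → Fin N)
  (node-root : parent (node zero) ≡ nothing)
  (node-parent : ∀ i → parent (node (suc i)) ≡ just (node (inject₁ i))) where

  depth-node : ∀ i → Depth parent (node i) (suc (toℕ i))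
  depth-node = <-weakInduction (λ i → Depth parent (node i) (suc (toℕ i))) (root node-root)
    λ i d → child (node-parent i) (subst (Depth parent (node (inject₁ i)) ∘ suc) (toℕ-inject₁ i) d)

  ancestor-node : ∀ {i j} → i Fin.< j → Ancestor parent (node i) (node j)
  ancestor-node {i} {j} = <-weakInduction Below (λ _ ()) extend j i
    where
    Below : Fin (suc K) → Set
    Below j = ∀ i → i Fin.< j → Ancestor parent (node i) (node j)
    extend : ∀ j → Below (inject₁ j) → Below (suc j)
    extend j below i i<1+j with i Fin.≟ inject₁ j
    ... | yes refl = par (node-parent j)
    ... | no i≢j   = step (below i (≤∧≢⇒< (<⇒≤pred i<1+j) i≢j)) (node-parent j)

  ancestor-child-of-last : ∀ {v} → parent v ≡ just (node (fromℕ K)) → ∀ i → Ancestor parent (node i) v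
  ancestor-child-of-last pv i with i Fin.≟ fromℕ K
  ... | yes refl = par pv
  ... | no i≢K   = step (ancestor-node (≤∧≢⇒< (≤fromℕ i) i≢K)) pv

module Relabelling {V : Set} {N : ℕ} (ι : Fin N ↔ V) (E : V → V → Set) (E-irrefl : ∀ {x} → ¬ E x x) where
  open Inverse ι using (to; from; strictlyInverseˡ; strictlyInverseʳ)

  Adjᵥ : V → V → Set
  Adjᵥ x y = E x y ⊎ E y x

  graph : Graph N
  graph = record { Adj = λ u v → Adjᵥ (to u) (to v) ; sym = swap ; irrefl = [ E-irrefl , E-irrefl ] }

  Near : V → V → Set
  Near x y = Adjᵥ x y ⊎ ∃[ z ] Adjᵥ x z × Adjᵥ z y

  near-sym : ∀ {x y} → Near x y → Near y x
  near-sym (inj₁ xy)            = inj₁ (swap xy)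
  near-sym (inj₂ (z , xz , zy)) = inj₂ (z , swap zy , swap xz)

  square-adj⁺ : ∀ {u v} → u ≢ v → Near (to u) (to v) → Adj (square graph) u v
  square-adj⁺ u≢v (inj₁ uv)            = u≢v , inj₁ uv
  square-adj⁺ {u} {v} u≢v (inj₂ (z , uz , zv)) =
    u≢v , inj₂ (from z , subst (Adjᵥ (to u)) (sym (strictlyInverseˡ z)) uz
                       , subst (λ w → Adjᵥ w (to v)) (sym (strictlyInverseˡ z)) zv)

  square-adj⁻ : ∀ {u v} → Adj (square graph) u v → Near (to u) (to v)
  square-adj⁻ (_ , inj₁ uv)            = inj₁ uv
  square-adj⁻ (_ , inj₂ (w , uw , wv)) = inj₂ (to w , uw , wv)

  module _ {P : Pred V 0ℓ} (P? : Decidable P) where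

    cliqueOf : Subset N
    cliqueOf = toSubset (P? ∘ to)

    from∈cliqueOf : ∀ {x} → P x → from x ∈ cliqueOf
    from∈cliqueOf {x} px = ∈-toSubset⁺ (P? ∘ to) (subst P (sym (strictlyInverseˡ x)) px)

    from∈cliqueOf⁻ : ∀ {x} → from x ∈ cliqueOf → P x
    from∈cliqueOf⁻ {x} x∈ = subst P (strictlyInverseˡ x) (∈-toSubset⁻ (P? ∘ to) x∈)

    isMaximalClique-cliqueOf :
      (∀ {x y} → P x → P y → x ≢ y → Near x y) →
      (∀ {x} → ¬ P x → ∃[ y ] P y × ¬ Near x y) →
      IsMaximalClique (square graph) cliqueOf
    isMaximalClique-cliqueOf clique escape = isMaximalClique-byEscape (square graph) cliqueOf clique′ escape′
      where
      clique′ : IsClique (square graph) cliqueOf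
      clique′ u v u∈ v∈ u≢v = square-adj⁺ u≢v
        (clique (∈-toSubset⁻ (P? ∘ to) u∈) (∈-toSubset⁻ (P? ∘ to) v∈) (u≢v ∘ Injection.injective (↔⇒↣ ι)))
      escape′ : ∀ {u} → u ∉ cliqueOf → ∃[ v ] v ∈ cliqueOf × ¬ Adj (square graph) u v
      escape′ {u} u∉ with y , py , ¬near ← escape (u∉ ∘ ∈-toSubset⁺ (P? ∘ to))
        = from y , from∈cliqueOf py , ¬near ∘ subst (Near (to u)) (strictlyInverseˡ y) ∘ square-adj⁻

  module Forest (parentᵥ : V → Maybe V) where

    parent : Fin N → Maybe (Fin N)
    parent = Maybe.map from ∘ parentᵥ ∘ to

    parent-from : ∀ x → parent (from x) ≡ Maybe.map from (parentᵥ x)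
    parent-from x = cong (Maybe.map from ∘ parentᵥ) (strictlyInverseˡ x)

    treedepth : ∀ {h} → (∀ x → ∃[ k ] Depth parent (from x) k × k ≤ h) →
      (∀ {x y} → E x y → Ancestor parent (from x) (from y)) → TreedepthAtMost graph h
    treedepth {h} depth ancestor = parent , depth′ , edge
      where
      depth′ : ∀ u → ∃[ k ] Depth parent u k × k ≤ h
      depth′ u = subst (λ w → ∃[ k ] Depth parent w k × k ≤ h) (strictlyInverseʳ u) (depth (to u))
      ancestor′ : ∀ {u v} → E (to u) (to v) → Ancestor parent u v
      ancestor′ {u} {v} = subst₂ (Ancestor parent) (strictlyInverseʳ u) (strictlyInverseʳ v) ∘ ancestor
      edge : ∀ u v → Adj graph u v → Ancestor parent u v ⊎ Ancestor parent v u
      edge u v = ⊎-map ancestor′ ancestor′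

-- The a-vertices of block p see the hubs in A p, the b-vertices those outside it; the
-- fields are what puts all hubs and one a/b-pair per block within distance 2.
record HubSystem (m H : ℕ) : Set where
  field
    A        : Fin m → Subset H
    core     : Fin H
    core∈A   : ∀ p → core ∈ A p
    separate : ∀ {p q} → p ≢ q → ∃[ h ] h ∈ A p × h ∉ A q
    avoid    : ∀ p q → ∃[ h ] h ∉ A p × h ∉ A q

-- A p = {0} ∪ (an e-subset of the other 2e + 1 hubs): one d-set, d = e + 1, from each
-- complementary pair of d-subsets of the 2d hubs, hence C(2d,d)/2 blocks.
middleLayer : ∀ e → HubSystem ((2 * suc e ∸ 1) C e) (2 * suc e)
middleLayer e = record
  { A        = λ p → inside ∷ choose K e p
  ; core     = zero
  ; core∈A   = λ _ → here
  ; separate = λ {p} {q} p≢q →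
      let x , x∈p , x∉q = ∣q∣≤∣p∣∧p≢q⇒∃∈p∉q (≤-reflexive (trans (∣choose∣≡k K e q) (sym (∣choose∣≡k K e p))))
                                             (p≢q ∘ choose-injective K e)
      in suc x , there x∈p , x∉q ∘ drop-there
  ; avoid    = λ p q →
      let x , x∉p , x∉q = ∣p∣+∣q∣<n⇒∃∉p∉q (choose K e p) (choose K e q)
                            (subst (_< K) (sym (cong₂ _+_ (∣choose∣≡k K e p) (∣choose∣≡k K e q)))
                                   (+-monoʳ-< e (s≤s (m≤m+n e 0))))
      in suc x , x∉p ∘ drop-there , x∉q ∘ drop-there
  }
  where
  K : ℕ
  K = 2 * suc e ∸ 1

module Construction (n K : ℕ) {m} (𝒜 : HubSystem m (suc K)) where
  open HubSystem 𝒜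

  Vertex : Set
  Vertex = ((Fin 3 × Fin m) × Fin n) ⊎ Fin (suc K)

  pattern hub h = inj₂ h
  pattern a p j = inj₁ ((zero , p) , j)
  pattern b p j = inj₁ ((suc zero , p) , j)
  pattern c p j = inj₁ ((suc (suc zero) , p) , j)

  -- Each edge points from an ancestor to a descendant in the forest parentᵥ below.
  data Edge : Vertex → Vertex → Set where
    hub-hub : ∀ {h h′} → h Fin.< h′ → Edge (hub h) (hub h′)
    hub-a   : ∀ {h p j} → h ∈ A p → Edge (hub h) (a p j)
    hub-b   : ∀ {h p j} → h ∉ A p → Edge (hub h) (b p j)
    c-a     : ∀ {p j} → Edge (c p j) (a p j)
    c-b     : ∀ {p j} → Edge (c p j) (b p j)

  Edge-irrefl : ∀ {x} → ¬ Edge x x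
  Edge-irrefl (hub-hub h<h) = Finₚ.<-irrefl refl h<h

  vertices : Fin (3 * m * n + suc K) ↔ Vertex
  vertices = (((*↔× ×-↔ ↔-id _) ↔-∘ *↔×) ⊎-↔ ↔-id _) ↔-∘ +↔⊎

  open Relabelling vertices Edge Edge-irrefl public
  open Inverse vertices using (from)

  parentᵥ : Vertex → Maybe Vertex
  parentᵥ (hub zero)    = nothing
  parentᵥ (hub (suc i)) = just (hub (inject₁ i))
  parentᵥ (a p j)       = just (c p j)
  parentᵥ (b p j)       = just (c p j)
  parentᵥ (c p j)       = just (hub (fromℕ K))

  open Forest parentᵥ
  open Chain parent (from ∘ hub) (parent-from (hub zero)) (λ i → parent-from (hub (suc i)))

  depth-last-hub : Depth parent (from (hub (fromℕ K))) (suc K)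
  depth-last-hub = subst (Depth parent (from (hub (fromℕ K))) ∘ suc) (toℕ-fromℕ K) (depth-node (fromℕ K))

  depth-c : ∀ p j → Depth parent (from (c p j)) (2 + K)
  depth-c p j = child (parent-from (c p j)) depth-last-hub

  leaf-bound : 3 + K ≤ suc K + 2
  leaf-bound = ≤-reflexive (+-comm 2 (suc K))

  depth : ∀ x → ∃[ k ] Depth parent (from x) k × k ≤ suc K + 2
  depth (hub h) = suc (toℕ h) , depth-node h , ≤-trans (toℕ<n h) (m≤m+n (suc K) 2)
  depth (c p j) = 2 + K , depth-c p j , ≤-trans (n≤1+n _) leaf-bound
  depth (a p j) = 3 + K , child (parent-from (a p j)) (depth-c p j) , leaf-bound
  depth (b p j) = 3 + K , child (parent-from (b p j)) (depth-c p j) , leaf-bound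

  hub-ancestor-c : ∀ h p j → Ancestor parent (from (hub h)) (from (c p j))
  hub-ancestor-c h p j = ancestor-child-of-last (parent-from (c p j)) h

  edge-ancestor : ∀ {x y} → Edge x y → Ancestor parent (from x) (from y)
  edge-ancestor (hub-hub h<h′)        = ancestor-node h<h′
  edge-ancestor (hub-a {h} {p} {j} _) = step (hub-ancestor-c h p j) (parent-from (a p j))
  edge-ancestor (hub-b {h} {p} {j} _) = step (hub-ancestor-c h p j) (parent-from (b p j))
  edge-ancestor (c-a {p} {j})         = par (parent-from (a p j))
  edge-ancestor (c-b {p} {j})         = par (parent-from (b p j))

  graph-treedepth : TreedepthAtMost graph (suc K + 2)
  graph-treedepth = treedepth depth edge-ancestor

  hub-adj : ∀ {h h′} → h ≢ h′ → Adjᵥ (hub h) (hub h′)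
  hub-adj {h} {h′} h≢h′ with <-cmp h h′
  ... | tri< h<h′ _ _ = inj₁ (hub-hub h<h′)
  ... | tri≈ _ h≡h′ _ = ⊥-elim (h≢h′ h≡h′)
  ... | tri> _ _ h′<h = inj₂ (hub-hub h′<h)

  near-hub-a : ∀ h p j → Near (hub h) (a p j)
  near-hub-a h p j with h ∈? A p
  ... | yes h∈A = inj₁ (inj₁ (hub-a h∈A))
  ... | no h∉A  = inj₂ (hub core , hub-adj (λ { refl → h∉A (core∈A p) }) , inj₁ (hub-a (core∈A p)))

  near-hub-b : ∀ h p j → Near (hub h) (b p j)
  near-hub-b h p j with h ∈? A p
  ... | no h∉A  = inj₁ (inj₁ (hub-b h∉A))
  ... | yes h∈A with h′ , h′∉A , _ ← avoid p p
    = inj₂ (hub h′ , hub-adj (λ { refl → h′∉A h∈A }) , inj₁ (hub-b h′∉A))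

  near-hub-c : ∀ h p j → Near (hub h) (c p j)
  near-hub-c h p j with h ∈? A p
  ... | yes h∈A = inj₂ (a p j , inj₁ (hub-a h∈A) , inj₂ c-a)
  ... | no h∉A  = inj₂ (b p j , inj₁ (hub-b h∉A) , inj₂ c-b)

  near-a-a : ∀ p j q k → Near (a p j) (a q k)
  near-a-a p j q k = inj₂ (hub core , inj₂ (hub-a (core∈A p)) , inj₁ (hub-a (core∈A q)))

  near-b-b : ∀ p j q k → Near (b p j) (b q k)
  near-b-b p j q k with h , h∉Ap , h∉Aq ← avoid p q = inj₂ (hub h , inj₂ (hub-b h∉Ap) , inj₁ (hub-b h∉Aq))

  near-a-b : ∀ (f : Fin m → Fin n) p q → Near (a p (f p)) (b q (f q))
  near-a-b f p q with p Fin.≟ q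
  ... | yes refl = inj₂ (c p (f p) , inj₂ c-a , inj₁ c-b)
  ... | no p≢q with h , h∈Ap , h∉Aq ← separate p≢q = inj₂ (hub h , inj₂ (hub-a h∈Ap) , inj₁ (hub-b h∉Aq))

  far-a-b : ∀ {p j k} → Near (a p j) (b p k) → j ≡ k
  far-a-b (inj₁ (inj₁ ()))
  far-a-b (inj₁ (inj₂ ()))
  far-a-b (inj₂ (_ , inj₁ () , _))
  far-a-b (inj₂ (_ , _ , inj₂ ()))
  far-a-b (inj₂ (_ , inj₂ (hub-a h∈A) , inj₁ (hub-b h∉A))) = ⊥-elim (h∉A h∈A)
  far-a-b (inj₂ (_ , inj₂ c-a , inj₁ c-b)) = refl

  far-c-a : ∀ {p j q k} → Near (c p j) (a q k) → p ≡ q × j ≡ k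
  far-c-a (inj₁ (inj₁ c-a)) = refl , refl
  far-c-a (inj₁ (inj₂ ()))
  far-c-a (inj₂ (_ , inj₂ () , _))
  far-c-a (inj₂ (_ , inj₁ c-a , inj₁ ()))
  far-c-a (inj₂ (_ , inj₁ c-a , inj₂ ()))
  far-c-a (inj₂ (_ , inj₁ c-b , inj₁ ()))
  far-c-a (inj₂ (_ , inj₁ c-b , inj₂ ()))

  -- c_{p,j} is at distance 3 from the a-vertices of other blocks, so it can only join
  -- when p is the sole block.
  Chosen : (Fin m → Fin n) → Vertex → Set
  Chosen f (hub h) = ⊤
  Chosen f (a p j) = j ≡ f p
  Chosen f (b p j) = j ≡ f p
  Chosen f (c p j) = j ≡ f p × (∀ q → q ≡ p)

  chosen? : ∀ f → Decidable (Chosen f)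
  chosen? f (hub h) = yes tt
  chosen? f (a p j) = j Fin.≟ f p
  chosen? f (b p j) = j Fin.≟ f p
  chosen? f (c p j) = (j Fin.≟ f p) ×-dec all? (Fin._≟ p)

  chosen-near : ∀ f {x y} → Chosen f x → Chosen f y → x ≢ y → Near x y
  chosen-near f {hub h} {hub h′} _ _ x≢y = inj₁ (hub-adj (x≢y ∘ cong hub))
  chosen-near f {hub h} {a p j}  _ _ _   = near-hub-a h p j
  chosen-near f {hub h} {b p j}  _ _ _   = near-hub-b h p j
  chosen-near f {hub h} {c p j}  _ _ _   = near-hub-c h p j
  chosen-near f {a p j} {hub h}  _ _ _   = near-sym (near-hub-a h p j)
  chosen-near f {b p j} {hub h}  _ _ _   = near-sym (near-hub-b h p j)
  chosen-near f {c p j} {hub h}  _ _ _   = near-sym (near-hub-c h p j)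
  chosen-near f {a p j} {a q k}  _ _ _   = near-a-a p j q k
  chosen-near f {b p j} {b q k}  _ _ _   = near-b-b p j q k
  chosen-near f {a p _} {b q _}  refl refl _ = near-a-b f p q
  chosen-near f {b p _} {a q _}  refl refl _ = near-sym (near-a-b f q p)
  chosen-near f {a p _} {c q _}  refl (refl , only-q) _ with refl ← only-q p = inj₁ (inj₂ c-a)
  chosen-near f {b p _} {c q _}  refl (refl , only-q) _ with refl ← only-q p = inj₁ (inj₂ c-b)
  chosen-near f {c p _} {a q _}  (refl , only-p) refl _ with refl ← only-p q = inj₁ (inj₁ c-a)
  chosen-near f {c p _} {b q _}  (refl , only-p) refl _ with refl ← only-p q = inj₁ (inj₁ c-b)
  chosen-near f {c p _} {c q _}  (refl , only-p) (refl , _) c≢c with refl ← only-p q = ⊥-elim (c≢c refl)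

  chosen-escape : ∀ f {x} → ¬ Chosen f x → ∃[ y ] Chosen f y × ¬ Near x y
  chosen-escape f {hub h} unchosen = ⊥-elim (unchosen tt)
  chosen-escape f {a p j} j≢fp = b p (f p) , refl , j≢fp ∘ far-a-b
  chosen-escape f {b p j} j≢fp = a p (f p) , refl , j≢fp ∘ sym ∘ far-a-b ∘ near-sym
  chosen-escape f {c p j} unchosen with j Fin.≟ f p
  ... | no j≢fp = a p (f p) , refl , j≢fp ∘ proj₂ ∘ far-c-a
  ... | yes j≡fp with q , q≢p ← ¬∀⟶∃¬ m (_≡ p) (Fin._≟ p) (unchosen ∘ (j≡fp ,_))
    = a q (f q) , refl , q≢p ∘ sym ∘ proj₁ ∘ far-c-a

  clique : (Fin m → Fin n) → Subset (3 * m * n + suc K)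
  clique f = cliqueOf (chosen? f)

  clique-injective : ∀ {f g} → clique f ≡ clique g → f ≗ g
  clique-injective {f} {g} eq p =
    from∈cliqueOf⁻ (chosen? g) {a p (f p)} (subst (from (a p (f p)) ∈_) eq (from∈cliqueOf (chosen? f) {a p (f p)} refl))

  square-maxCliques : AtLeastMaxCliques (square graph) (n ^ m)
  square-maxCliques = atLeastMaxCliques-^ (square graph) clique clique-injective
    λ f → isMaximalClique-cliqueOf (chosen? f) (chosen-near f) (chosen-escape f)

theorem6p5 : (n d : ℕ) → 1 ≤ d →
    Σ ℕ λ N → Σ (Graph N) λ G →
      (N ≡ 3 * (((2 * d) C d) / 2) * n + 2 * d) ×
      TreedepthAtMost G (2 * d + 2) ×
      AtLeastMaxCliques (square G) (n ^ (((2 * d) C d) / 2))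
theorem6p5 n (suc e) _ =
  3 * m * n + 2 * suc e , graph ,
  cong (λ k → 3 * k * n + 2 * suc e) m≡ ,
  graph-treedepth ,
  subst (λ k → AtLeastMaxCliques (square graph) (n ^ k)) m≡ square-maxCliques
  where
  m : ℕ
  m = (2 * suc e ∸ 1) C e
  m≡ : m ≡ ((2 * suc e) C suc e) / 2
  m≡ = sym ([2+2e]C[1+e]/2≡[1+2e]Ce e)
  open Construction n (2 * suc e ∸ 1) (middleLayer e)
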